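{- Let $P$ be a non-nesting partition of $\{1,\dots,n\}$ and, for $1\le i<j\le n$, let $\eta_{i,j}$ be the maximal number of pairwise non-crossing arcs of $P$ lying between $i$ and $j$. Then for all $1\le a<b<c\le n$ there is $\varepsilon\in\{0,1\}$ (depending on $a,b,c$) such that $\eta_{a,c}=\eta_{a,b}+\eta_{b,c}+\varepsilon$.
   Context: For a partition $P=\{P_1,\dots,P_k\}$ of $\{1,\dots,n\}$ with each block written increasingly $P_i=\{p_{i,1}<\dots<p_{i,k_i}\}$, the arcs of $P$ are the pairs $[p_{i,j},p_{i,j+1}]$ for $1\le i\le k$, $1\le j<k_i$. Two arcs $[a,b]$, $[c,d]$ with $a<b$, $c<d$, $a<c$ are crossing if $a<c<b<d$ and nesting if $a<c<d<b$. $P$ is non-nesting if no two of its arcs are nesting. An arc $[p,q]$ ($p<q$) lies between $i$ and $j$ ($i<j$) if $i\le p<q\le j$. -}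

module Defs where

open import Data.Nat using (ℕ; zero; suc; _<_; _≤_; _<?_; _≤?_; _⊔_)
open import Data.Nat.Properties using (<-cmp)
open import Data.List using (List; []; _∷_; map; filter; concat; length; foldr; upTo; _++_)
open import Data.List.Relation.Unary.Linked using (Linked)
open import Data.List.Relation.Unary.All using (All)
open import Data.List.Relation.Unary.AllPairs using (AllPairs; allPairs?)
open import Data.List.Relation.Binary.Permutation.Propositional using (_↭_)
open import Data.List.Membership.Propositional using (_∈_)
open import Data.Product using (_×_; _,_)
open import Data.Sum using (_⊎_; inj₁; inj₂)
open import Relation.Nullary using (¬_; Dec; yes; no)
open import Relation.Nullary.Decidable using (_×-dec_; ¬?)
open import Relation.Binary.PropositionalEquality using (_≢_)

-- A set partition of {1,…,n}, given as a list of blocks; each block is a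
-- nonempty list written strictly increasingly, and the blocks together
-- contain every element of {1,…,n} exactly once.
Partition : Set
Partition = List (List ℕ)

IsPartition : ℕ → Partition → Set
IsPartition n P =
  All (λ B → B ≢ []) P × All (Linked _<_) P × (concat P ↭ map suc (upTo n))

Arc : Set
Arc = ℕ × ℕ

blockArcs : List ℕ → List Arc
blockArcs []           = []
blockArcs (x ∷ [])     = []
blockArcs (x ∷ y ∷ xs) = (x , y) ∷ blockArcs (y ∷ xs)

arcs : Partition → List Arc
arcs P = concat (map blockArcs P)

CrossingOrdered : Arc → Arc → Set
CrossingOrdered (a , b) (c , d) = a < c × c < b × b < d

NestingOrdered : Arc → Arc → Set
NestingOrdered (a , b) (c , d) = a < c × c < d × d < b

Crossing : Arc → Arc → Set
Crossing x y = CrossingOrdered x y ⊎ CrossingOrdered y x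

Nesting : Arc → Arc → Set
Nesting x y = NestingOrdered x y ⊎ NestingOrdered y x

NonNesting : Partition → Set
NonNesting P = ∀ x y → x ∈ arcs P → y ∈ arcs P → ¬ Nesting x y

LiesBetween : ℕ → ℕ → Arc → Set
LiesBetween i j (p , q) = i ≤ p × p < q × q ≤ j

liesBetween? : ∀ i j x → Dec (LiesBetween i j x)
liesBetween? i j (p , q) = (i ≤? p) ×-dec ((p <? q) ×-dec (q ≤? j))

crossingOrdered? : ∀ x y → Dec (CrossingOrdered x y)
crossingOrdered? (a , b) (c , d) = (a <? c) ×-dec ((c <? b) ×-dec (b <? d))

nonCrossing? : ∀ x y → Dec (¬ Crossing x y)
nonCrossing? x y with crossingOrdered? x y | crossingOrdered? y x
... | yes p | _     = no (λ f → f (inj₁ p))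
... | no _  | yes q = no (λ f → f (inj₂ q))
... | no p  | no q  = yes λ { (inj₁ r) → p r ; (inj₂ r) → q r }

-- all sublists (subsets, as the list of arcs of a partition has no repetitions)
sublists : {A : Set} → List A → List (List A)
sublists []       = [] ∷ []
sublists (x ∷ xs) = let s = sublists xs in map (x ∷_) s ++ s

maximum : List ℕ → ℕ
maximum = foldr _⊔_ 0

η : Partition → ℕ → ℕ → ℕ
η P i j =
  maximum (map length
    (filter (allPairs? nonCrossing?)
      (sublists (filter (liesBetween? i j) (arcs P)))))

-- Split the arcs lying between a and c into those between a and b, those between b and c,
-- and those straddling b (p < b < q). Arcs of the first two kinds never cross, so optimal
-- non-crossing sets for (a,b) and (b,c) combine into one for (a,c): η_{a,b} + η_{b,c} ≤ η_{a,c}.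
-- Two distinct arcs straddling b have distinct left and distinct right endpoints (every
-- element lies in exactly one block), so they cross or nest; in a non-nesting partition a
-- non-crossing set therefore contains at most one of them, whence η_{a,c} ≤ η_{a,b} + η_{b,c} + 1.
module Submission where

open import Defs
open import Data.Nat using (ℕ; _+_; _<_; _≤_; _<?_; _≤?_; z≤n; s≤s)
open import Data.Nat.Properties
open import Data.List using (List; []; _∷_; _++_; map; concat; filter; length)
open import Data.List.Properties using (length-++; map-++; filter-all)
open import Data.List.Membership.Propositional using (_∈_; _∉_)
open import Data.List.Membership.Propositional.Properties using (∈-map⁺; ∈-map⁻; ∈-++⁺ˡ; ∈-++⁺ʳ; ∈-++⁻; ∈-filter⁺; ∈-filter⁻)
open import Data.List.Relation.Unary.Any using (here; there)
open import Data.List.Relation.Unary.All as All using (All; []; _∷_)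
import Data.List.Relation.Unary.All.Properties as Allₚ
open import Data.List.Relation.Unary.AllPairs using (AllPairs; []; _∷_; allPairs?)
import Data.List.Relation.Unary.AllPairs.Properties as AllPairs
open import Data.List.Relation.Unary.Unique.Propositional using (Unique)
import Data.List.Relation.Unary.Unique.Propositional.Properties as Unique
open import Data.List.Relation.Binary.Sublist.Propositional using (_⊆_; []; _∷_; _∷ʳ_; ⊆-trans; minimum)
open import Data.List.Relation.Binary.Sublist.Propositional.Properties using (map⁺; ++⁺; filter-⊆; filter⁺; All-resp-⊆; Any-resp-⊆)
open import Data.List.Relation.Binary.Permutation.Propositional using (_↭_; ↭-refl; ↭-sym; ↭-trans; prep; ↭⇒↭ₛ)
open import Data.List.Relation.Binary.Permutation.Propositional.Properties using (↭-length; All-resp-↭; shift)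
import Data.List.Relation.Binary.Permutation.Setoid.Properties as Permutationₛ
open import Data.Product using (Σ; ∃; _×_; _,_; proj₁; proj₂)
open import Data.Sum using (_⊎_; inj₁; inj₂)
open import Data.Empty using (⊥-elim)
open import Function using (_∘_)
open import Relation.Nullary using (¬_; Dec; yes; no)
open import Relation.Nullary.Decidable using (_×-dec_; _⊎-dec_)
open import Relation.Unary using (Decidable)
open import Relation.Binary using (Symmetric; tri<; tri≈; tri>)
open import Relation.Binary.PropositionalEquality using (_≡_; _≢_; refl; sym; trans; cong₂; ≢-sym; subst; resp₂; setoid)

module _ {A : Set} where

  ⊆⇒∈-sublists : {xs ys : List A} → xs ⊆ ys → xs ∈ sublists ys
  ⊆⇒∈-sublists [] = here refl
  ⊆⇒∈-sublists {ys = y ∷ ys} (y ∷ʳ τ) = ∈-++⁺ʳ (map (y ∷_) (sublists ys)) (⊆⇒∈-sublists τ)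
  ⊆⇒∈-sublists (refl ∷ τ) = ∈-++⁺ˡ (∈-map⁺ _ (⊆⇒∈-sublists τ))

  ∈-sublists⇒⊆ : (ys : List A) {xs : List A} → xs ∈ sublists ys → xs ⊆ ys
  ∈-sublists⇒⊆ [] (here refl) = []
  ∈-sublists⇒⊆ (y ∷ ys) m with ∈-++⁻ (map (y ∷_) (sublists ys)) m
  ... | inj₂ m′ = y ∷ʳ ∈-sublists⇒⊆ ys m′
  ... | inj₁ m′ with ∈-map⁻ (y ∷_) m′
  ...   | _ , m″ , refl = refl ∷ ∈-sublists⇒⊆ ys m″

  AllPairs-resp-⊇ : {R : A → A → Set} {xs ys : List A} → xs ⊆ ys → AllPairs R ys → AllPairs R xs
  AllPairs-resp-⊇ [] [] = []
  AllPairs-resp-⊇ (_ ∷ʳ τ) (_ ∷ rs) = AllPairs-resp-⊇ τ rs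
  AllPairs-resp-⊇ (refl ∷ τ) (r ∷ rs) = All-resp-⊆ τ r ∷ AllPairs-resp-⊇ τ rs

  AllPairs-resp-↭ : {R : A → A → Set} → Symmetric R →
                    {xs ys : List A} → xs ↭ ys → AllPairs R xs → AllPairs R ys
  AllPairs-resp-↭ {R} R-sym p = Permutationₛ.AllPairs-resp-↭ (setoid A) R-sym (resp₂ R) (↭⇒↭ₛ p)

  ⊆-disjoint-union : {xs ys zs : List A} → xs ⊆ zs → ys ⊆ zs → (∀ {x} → x ∈ xs → x ∉ ys) →
                     ∃ λ us → us ⊆ zs × us ↭ xs ++ ys
  ⊆-disjoint-union [] [] _ = [] , [] , ↭-refl
  ⊆-disjoint-union (z ∷ʳ τ₁) (.z ∷ʳ τ₂) disj with ⊆-disjoint-union τ₁ τ₂ disj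
  ... | us , τ , p = us , z ∷ʳ τ , p
  ⊆-disjoint-union (refl ∷ τ₁) (z ∷ʳ τ₂) disj with ⊆-disjoint-union τ₁ τ₂ (disj ∘ there)
  ... | us , τ , p = z ∷ us , refl ∷ τ , prep z p
  ⊆-disjoint-union {xs = xs} {y ∷ ys} (z ∷ʳ τ₁) (refl ∷ τ₂) disj
    with ⊆-disjoint-union τ₁ τ₂ (λ m m′ → disj m (there m′))
  ... | us , τ , p = z ∷ us , refl ∷ τ , ↭-trans (prep z p) (↭-sym (shift z xs ys))
  ⊆-disjoint-union (refl ∷ _) (refl ∷ _) disj = ⊥-elim (disj (here refl) (here refl))

∈⇒≤-maximum : ∀ {m} (ms : List ℕ) → m ∈ ms → m ≤ maximum ms
∈⇒≤-maximum (m ∷ ms) (here refl) = m≤m⊔n m (maximum ms)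
∈⇒≤-maximum (m ∷ ms) (there i) = m≤n⇒m≤o⊔n m (∈⇒≤-maximum ms i)

maximum≡0⊎maximum∈ : (ms : List ℕ) → maximum ms ≡ 0 ⊎ maximum ms ∈ ms
maximum≡0⊎maximum∈ [] = inj₁ refl
maximum≡0⊎maximum∈ (m ∷ ms) with ⊔-sel m (maximum ms) | maximum≡0⊎maximum∈ ms
... | inj₁ eq | _ = inj₂ (here eq)
... | inj₂ eq | inj₁ eq′ = inj₁ (trans eq eq′)
... | inj₂ eq | inj₂ i = inj₂ (there (subst (_∈ ms) (sym eq) i))

module _ {A : Set} {R : A → A → Set} (R? : ∀ x y → Dec (R x y)) where

  largestPairwise : List A → ℕ
  largestPairwise L = maximum (map length (filter (allPairs? R?) (sublists L)))

  pairwise⇒length≤largestPairwise : ∀ {S L} → S ⊆ L → AllPairs R S → length S ≤ largestPairwise L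
  pairwise⇒length≤largestPairwise τ rs =
    ∈⇒≤-maximum _ (∈-map⁺ length (∈-filter⁺ (allPairs? R?) (⊆⇒∈-sublists τ) rs))

  largestPairwise-attained : ∀ L → ∃ λ S → S ⊆ L × AllPairs R S × length S ≡ largestPairwise L
  largestPairwise-attained L with maximum≡0⊎maximum∈ (map length (filter (allPairs? R?) (sublists L)))
  ... | inj₁ eq = [] , minimum L , [] , sym eq
  ... | inj₂ i with ∈-map⁻ length i
  ...   | S , j , eq with ∈-filter⁻ (allPairs? R?) j
  ...     | k , rs = S , ∈-sublists⇒⊆ L k , rs , sym eq

NonCrossing : Arc → Arc → Set
NonCrossing x y = ¬ Crossing x y

NonCrossing-sym : Symmetric NonCrossing
NonCrossing-sym nc (inj₁ c) = nc (inj₂ c)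
NonCrossing-sym nc (inj₂ c) = nc (inj₁ c)

module _ (P : Partition) (i j : ℕ) where

  η-maximal : ∀ {S} → S ⊆ arcs P → All (LiesBetween i j) S → AllPairs NonCrossing S →
              length S ≤ η P i j
  η-maximal {S} τ between nc = pairwise⇒length≤largestPairwise nonCrossing? τ′ nc
    where
    τ′ : S ⊆ filter (liesBetween? i j) (arcs P)
    τ′ = subst (_⊆ _) (filter-all (liesBetween? i j) between)
           (filter⁺ (liesBetween? i j) (liesBetween? i j) (λ { refl b → b }) τ)

  η-attained : ∃ λ S → S ⊆ arcs P × All (LiesBetween i j) S × AllPairs NonCrossing S ×
                       length S ≡ η P i j
  η-attained with largestPairwise-attained nonCrossing? (filter (liesBetween? i j) (arcs P))
  ... | S , τ , nc , eq =
    S , ⊆-trans τ (filter-⊆ _ (arcs P)) , All-resp-⊆ τ (Allₚ.all-filter (liesBetween? i j) (arcs P)) , nc , eq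

LiesBetween-widenʳ : ∀ {a b c} x → b ≤ c → LiesBetween a b x → LiesBetween a c x
LiesBetween-widenʳ _ b≤c (a≤p , p<q , q≤b) = a≤p , p<q , ≤-trans q≤b b≤c

LiesBetween-widenˡ : ∀ {a b c} x → a ≤ b → LiesBetween b c x → LiesBetween a c x
LiesBetween-widenˡ _ a≤b (b≤p , p<q , q≤c) = ≤-trans a≤b b≤p , p<q , q≤c

consecutive-NonCrossing : ∀ {a b c} x y → LiesBetween a b x → LiesBetween b c y → NonCrossing x y
consecutive-NonCrossing _ _ (_ , _ , q≤b) (b≤r , _ , _) (inj₁ (_ , r<q , _)) =
  <-irrefl refl (<-≤-trans r<q (≤-trans q≤b b≤r))
consecutive-NonCrossing _ _ (_ , p<q , q≤b) (b≤r , _ , _) (inj₂ (r<p , _ , _)) =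
  <-irrefl refl (<-trans r<p (<-≤-trans p<q (≤-trans q≤b b≤r)))

consecutive-≢ : ∀ {a b c} x y → LiesBetween a b x → LiesBetween b c y → x ≢ y
consecutive-≢ _ _ (_ , p<q , q≤b) (b≤p , _ , _) refl = <-irrefl refl (<-≤-trans p<q (≤-trans q≤b b≤p))

η+η≤η : ∀ P {a b c} → a ≤ b → b ≤ c → η P a b + η P b c ≤ η P a c
η+η≤η P {a} {b} {c} a≤b b≤c with η-attained P a b | η-attained P b c
... | S₁ , τ₁ , between₁ , nc₁ , eq₁ | S₂ , τ₂ , between₂ , nc₂ , eq₂
  with ⊆-disjoint-union τ₁ τ₂
         (λ i₁ i₂ → consecutive-≢ _ _ (All.lookup between₁ i₁) (All.lookup between₂ i₂) refl)
... | T , τ , T↭ = begin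
  η P a b + η P b c           ≡⟨ sym (cong₂ _+_ eq₁ eq₂) ⟩
  length S₁ + length S₂       ≡⟨ sym (length-++ S₁) ⟩
  length (S₁ ++ S₂)           ≡⟨ sym (↭-length T↭) ⟩
  length T                    ≤⟨ η-maximal P a c τ (All-resp-↭ (↭-sym T↭) between)
                                   (AllPairs-resp-↭ NonCrossing-sym (↭-sym T↭) nc) ⟩
  η P a c                     ∎
  where
  open ≤-Reasoning
  between : All (LiesBetween a c) (S₁ ++ S₂)
  between = Allₚ.++⁺ (All.map (LiesBetween-widenʳ _ b≤c) between₁)
                     (All.map (LiesBetween-widenˡ _ a≤b) between₂)
  nc : AllPairs NonCrossing (S₁ ++ S₂)
  nc = AllPairs.++⁺ nc₁ nc₂
         (All.map (λ b₁ → All.map (consecutive-NonCrossing _ _ b₁) between₂) between₁)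

blockArcs-sources : ∀ B → map proj₁ (blockArcs B) ⊆ B
blockArcs-sources [] = []
blockArcs-sources (x ∷ []) = x ∷ʳ []
blockArcs-sources (x ∷ y ∷ xs) = refl ∷ blockArcs-sources (y ∷ xs)

blockArcs-targets : ∀ x xs → map proj₂ (blockArcs (x ∷ xs)) ⊆ xs
blockArcs-targets x [] = []
blockArcs-targets x (y ∷ ys) = refl ∷ blockArcs-targets y ys

arcs-endpoints⊆ : (f : Arc → ℕ) → (∀ B → map f (blockArcs B) ⊆ B) → ∀ P → map f (arcs P) ⊆ concat P
arcs-endpoints⊆ f blocks [] = []
arcs-endpoints⊆ f blocks (B ∷ P) =
  subst (_⊆ B ++ concat P) (sym (map-++ f (blockArcs B) (arcs P)))
    (++⁺ (blocks B) (arcs-endpoints⊆ f blocks P))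

module _ {n P} (isP : IsPartition n P) where

  concat-Unique : Unique (concat P)
  concat-Unique =
    AllPairs-resp-↭ ≢-sym (↭-sym (proj₂ (proj₂ isP))) (Unique.map⁺ suc-injective (Unique.upTo⁺ n))

  sources-Unique : Unique (map proj₁ (arcs P))
  sources-Unique = AllPairs-resp-⊇ (arcs-endpoints⊆ proj₁ blockArcs-sources P) concat-Unique

  targets-Unique : Unique (map proj₂ (arcs P))
  targets-Unique = AllPairs-resp-⊇ (arcs-endpoints⊆ proj₂ targets P) concat-Unique
    where
    targets : ∀ B → map proj₂ (blockArcs B) ⊆ B
    targets [] = []
    targets (x ∷ xs) = x ∷ʳ blockArcs-targets x xs

Straddles : ℕ → Arc → Set
Straddles b (p , q) = p < b × b < q

straddles? : ∀ b → Decidable (Straddles b)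
straddles? b (p , q) = (p <? b) ×-dec (b <? q)

LiesBetween-split : ∀ {a c} b x → LiesBetween a c x → LiesBetween a b x ⊎ LiesBetween b c x ⊎ Straddles b x
LiesBetween-split b (p , q) (a≤p , p<q , q≤c) with q ≤? b | b ≤? p
... | yes q≤b | _       = inj₁ (a≤p , p<q , q≤b)
... | no _    | yes b≤p = inj₂ (inj₁ (b≤p , p<q , q≤c))
... | no q≰b  | no b≰p  = inj₂ (inj₂ (≰⇒> b≰p , ≰⇒> q≰b))

straddling-Crossing⊎Nesting : ∀ {b} x y → Straddles b x → Straddles b y →
                              proj₁ x ≢ proj₁ y → proj₂ x ≢ proj₂ y → Crossing x y ⊎ Nesting x y
straddling-Crossing⊎Nesting (p , q) (r , s) (p<b , b<q) (r<b , b<s) p≢r q≢s with <-cmp p r | <-cmp q s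
... | tri≈ _ p≡r _ | _            = ⊥-elim (p≢r p≡r)
... | _            | tri≈ _ q≡s _ = ⊥-elim (q≢s q≡s)
... | tri< p<r _ _ | tri< q<s _ _ = inj₁ (inj₁ (p<r , <-trans r<b b<q , q<s))
... | tri< p<r _ _ | tri> _ _ s<q = inj₂ (inj₁ (p<r , <-trans r<b b<s , s<q))
... | tri> _ _ r<p | tri> _ _ s<q = inj₁ (inj₂ (r<p , <-trans p<b b<s , s<q))
... | tri> _ _ r<p | tri< q<s _ _ = inj₂ (inj₂ (r<p , <-trans p<b b<q , q<s))

module _ {n P} (isP : IsPartition n P) (nonNesting : NonNesting P) where

  straddlers-length≤1 : ∀ {b S} → S ⊆ arcs P → All (Straddles b) S → AllPairs NonCrossing S →
                        length S ≤ 1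
  straddlers-length≤1 {S = []} _ _ _ = z≤n
  straddlers-length≤1 {S = _ ∷ []} _ _ _ = s≤s z≤n
  straddlers-length≤1 {S = x ∷ y ∷ _} τ (sx ∷ sy ∷ _) ((nc ∷ _) ∷ _)
    with AllPairs-resp-⊇ (map⁺ proj₁ τ) (sources-Unique isP)
       | AllPairs-resp-⊇ (map⁺ proj₂ τ) (targets-Unique isP)
  ... | (p≢r ∷ _) ∷ _ | (q≢s ∷ _) ∷ _ with straddling-Crossing⊎Nesting x y sx sy p≢r q≢s
  ...   | inj₁ crossing = ⊥-elim (nc crossing)
  ...   | inj₂ nesting =
    ⊥-elim (nonNesting x y (Any-resp-⊆ τ (here refl)) (Any-resp-⊆ τ (there (here refl))) nesting)

module _ {A : Set} {P Q : A → Set} (P? : Decidable P) (Q? : Decidable Q) where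

  length≤length-filter+length-filter : ∀ {xs} → All (λ x → P x ⊎ Q x) xs →
                                       length xs ≤ length (filter P? xs) + length (filter Q? xs)
  length≤length-filter+length-filter [] = z≤n
  length≤length-filter+length-filter {x ∷ xs} (px⊎qx ∷ rest)
    with P? x | Q? x | length≤length-filter+length-filter rest
  ... | yes _ | yes _ | ih = s≤s (≤-trans ih (+-monoʳ-≤ (length (filter P? xs)) (n≤1+n _)))
  ... | yes _ | no _  | ih = s≤s ih
  ... | no _  | yes _ | ih = ≤-trans (s≤s ih) (≤-reflexive (sym (+-suc _ _)))
  ... | no ¬p | no ¬q | _  with px⊎qx
  ...   | inj₁ px = ⊥-elim (¬p px)
  ...   | inj₂ qx = ⊥-elim (¬q qx)

η≤η+η+1 : ∀ {n P} → IsPartition n P → NonNesting P → ∀ a b c → η P a c ≤ η P a b + η P b c + 1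
η≤η+η+1 {P = P} isP nonNesting a b c with η-attained P a c
... | S , τ , between , nc , eq = begin
  η P a c                             ≡⟨ sym eq ⟩
  length S                            ≤⟨ length≤length-filter+length-filter (liesBetween? a b) right?
                                           (All.map (LiesBetween-split b _) between) ⟩
  length S₁ + length R                ≤⟨ +-monoʳ-≤ (length S₁)
                                           (length≤length-filter+length-filter (liesBetween? b c) (straddles? b)
                                             (Allₚ.all-filter right? S)) ⟩
  length S₁ + (length S₂ + length S₃) ≤⟨ +-mono-≤ S₁-bound (+-mono-≤ S₂-bound S₃-bound) ⟩
  η P a b + (η P b c + 1)             ≡⟨ sym (+-assoc (η P a b) _ 1) ⟩
  η P a b + η P b c + 1               ∎
  where
  open ≤-Reasoning
  right? : Decidable (λ x → LiesBetween b c x ⊎ Straddles b x)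
  right? x = liesBetween? b c x ⊎-dec straddles? b x
  R S₁ S₂ S₃ : List Arc
  R  = filter right? S
  S₁ = filter (liesBetween? a b) S
  S₂ = filter (liesBetween? b c) R
  S₃ = filter (straddles? b) R
  S₁⊆S : S₁ ⊆ S
  S₁⊆S = filter-⊆ _ S
  S₂⊆S : S₂ ⊆ S
  S₂⊆S = ⊆-trans (filter-⊆ _ R) (filter-⊆ right? S)
  S₃⊆S : S₃ ⊆ S
  S₃⊆S = ⊆-trans (filter-⊆ _ R) (filter-⊆ right? S)
  S₁-bound : length S₁ ≤ η P a b
  S₁-bound = η-maximal P a b (⊆-trans S₁⊆S τ) (Allₚ.all-filter (liesBetween? a b) S) (AllPairs-resp-⊇ S₁⊆S nc)
  S₂-bound : length S₂ ≤ η P b c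
  S₂-bound = η-maximal P b c (⊆-trans S₂⊆S τ) (Allₚ.all-filter (liesBetween? b c) R) (AllPairs-resp-⊇ S₂⊆S nc)
  S₃-bound : length S₃ ≤ 1
  S₃-bound = straddlers-length≤1 isP nonNesting (⊆-trans S₃⊆S τ) (Allₚ.all-filter (straddles? b) R)
               (AllPairs-resp-⊇ S₃⊆S nc)

m≤n≤m+1⇒n≡m+0or1 : ∀ {m n} → m ≤ n → n ≤ m + 1 → Σ ℕ (λ ε → (ε ≡ 0 ⊎ ε ≡ 1) × n ≡ m + ε)
m≤n≤m+1⇒n≡m+0or1 {m} m≤n n≤m+1 with m≤n⇒m<n∨m≡n m≤n
... | inj₂ m≡n = 0 , inj₁ refl , trans (sym m≡n) (sym (+-identityʳ m))
... | inj₁ m<n = 1 , inj₂ refl , ≤-antisym n≤m+1 (≤-trans (≤-reflexive (+-comm m 1)) m<n)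

lemma2p3 : (n : ℕ) (P : Partition) → IsPartition n P → NonNesting P →
    (a b c : ℕ) → 1 ≤ a → a < b → b < c → c ≤ n →
    Σ ℕ (λ ε → (ε ≡ 0 ⊎ ε ≡ 1) × η P a c ≡ η P a b + η P b c + ε)
lemma2p3 n P isP nonNesting a b c _ a<b b<c _ =
  m≤n≤m+1⇒n≡m+0or1 (η+η≤η P (<⇒≤ a<b) (<⇒≤ b<c)) (η≤η+η+1 isP nonNesting a b c)
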